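{- Let $\mathcal{X}$ be a connected $n$-premaniplex with base flag $x_0$, $N=\mathrm{Stab}_{\mathcal{C}^n}(x_0)$, and let $(\mathcal{Y},\eta)$ be an $(n,m)$-voltage operator that preserves connectivity, with base flag $y_0$ of $\mathcal{Y}$, $L=\mathrm{Stab}_{\mathcal{C}^m}(y_0)$ and $\zeta:L\to\mathcal{C}^n$, $\zeta(\omega)=\eta(P_\omega(y_0))$. If $\upsilon\in\mathrm{Norm}_{\mathcal{C}^m}(\zeta^{ -1}(N))\setminus L$, then $\mathcal{X}$ covers $\mathcal{Z}_\upsilon$, where $\mathcal{Z}_\upsilon=\mathcal{C}^n/\zeta(L\cap L^\upsilon)$.
   Context: A graph may have multiple edges and semi-edges. An $n$-premaniplex is such a graph with edges coloured by $\{0,\dots,n-1\}$ so that every vertex (flag) is the starting point of exactly one dart of each colour, and whenever $|i-j|\ge2$ every alternating path of length 4 with colours $i,j$ is closed; $x^i$ is the end of the $i$-dart at $x$. $\mathcal{C}^n=\langle r_0,\dots,r_{n-1}\mid r_i^2=1,\ (r_ir_j)^2=1\ (|i-j|\ge2)\rangle$ acts on the left on flags by $r_ix=x^i$; $\mathrm{Stab}$ denotes stabilisers, $\mathrm{Norm}$ normalisers, and $H^\upsilon=\upsilon^{ -1}H\upsilon$. A homomorphism of premaniplexes is a map of flags preserving all $i$-adjacencies; $\mathcal{X}$ covers $\mathcal{Z}$ if there is a surjective homomorphism $\mathcal{X}\to\mathcal{Z}$. For $K\le\mathcal{C}^n$ the coset premaniplex $\mathcal{C}^n/K$ has flags the left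 cosets $\omega K$ with $i$-adjacency $\omega K\mapsto r_i\omega K$. For a flag $y$ of an $m$-premaniplex $\mathcal{Y}$ and $\omega\in\mathcal{C}^m$, $P_\omega(y)$ is the homotopy class of paths from $y$ whose successive colours $i_1,\dots,i_k$ satisfy $r_{i_k}\cdots r_{i_1}=\omega$ (homotopic iff same start and same element of $\mathcal{C}^m$); they end at $\omega y$; these form the fundamental groupoid $\Pi(\mathcal{Y})$. A voltage assignment $\eta:\Pi(\mathcal{Y})\to\mathcal{C}^n$ satisfies $\eta(W_1W_2)=\eta(W_2)\eta(W_1)$; $(\mathcal{Y},\eta)$ is an $(n,m)$-voltage operator; with these conventions $\zeta$ is a group homomorphism, so $\zeta(L\cap L^\upsilon)$ is a subgroup. $\mathcal{X}\rtimes_\eta\mathcal{Y}$ is the $m$-premaniplex with flags $\mathcal{X}\times\mathcal{Y}$ and $(x,y)^i=(\eta(P_{r_i}(y))x,y^i)$. The operator preserves connectivity if $\mathcal{X}'\rtimes_\eta\mathcal{Y}$ is connected for every connected $n$-premaniplex $\mathcal{X}'$. Standing assumption: $\mathcal{Y}$ has a spanning tree all of whose darts have trivial voltage. -}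

module Defs where

open import Data.Nat using (ℕ; _≤_; ∣_-_∣)
open import Data.Fin using (Fin; toℕ)
open import Data.List using (List; []; _∷_; _++_; reverse; [_])
open import Data.Product using (Σ; ∃; _×_; _,_)
open import Data.Unit using (⊤)
open import Data.Empty using (⊥)
open import Relation.Nullary using (¬_)
open import Relation.Binary.PropositionalEquality using (_≡_; _≢_)

-- The group C^n = ⟨ r_0..r_{n-1} | r_i² = 1, (r_i r_j)² = 1 for |i-j| ≥ 2 ⟩
-- presented as words (lists of generators) modulo the congruence
-- generated by the defining relations.  The word  i₁ ∷ i₂ ∷ … ∷ i_k ∷ []
-- denotes the product r_{i₁} r_{i₂} ⋯ r_{i_k}.

Far : ∀ {n} → Fin n → Fin n → Set
Far i j = 2 ≤ ∣ toℕ i - toℕ j ∣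

Word : ℕ → Set
Word n = List (Fin n)

infix 4 _≈_
data _≈_ {n : ℕ} : Word n → Word n → Set where
  ≈-refl  : ∀ {u} → u ≈ u
  ≈-sym   : ∀ {u v} → u ≈ v → v ≈ u
  ≈-trans : ∀ {u v w} → u ≈ v → v ≈ w → u ≈ w
  ≈-inv   : ∀ a b i → (a ++ i ∷ i ∷ b) ≈ (a ++ b)
  ≈-comm  : ∀ a b i j → Far i j → (a ++ i ∷ j ∷ b) ≈ (a ++ j ∷ i ∷ b)

_·_ : ∀ {n} → Word n → Word n → Word n
u · v = u ++ v

infixr 7 _·_
infix 8 _⁻¹
_⁻¹ : ∀ {n} → Word n → Word n
u ⁻¹ = reverse u

record Premaniplex (n : ℕ) : Set₁ where
  field
    Flag    : Set
    adj     : Fin n → Flag → Flag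
    adj-inv : ∀ i x → adj i (adj i x) ≡ x
    adj-alt : ∀ i j x → Far i j → adj j (adj i (adj j (adj i x))) ≡ x
open Premaniplex public

act : ∀ {n} {F : Set} → (Fin n → F → F) → Word n → F → F
act adj′ [] x = x
act adj′ (i ∷ w) x = adj′ i (act adj′ w x)

ConnectedGraph : ∀ {n} (F : Set) → (Fin n → F → F) → Set
ConnectedGraph F adj′ = ∀ (x y : F) → ∃ λ (w : Word _) → act adj′ w x ≡ y

Connected : ∀ {n} → Premaniplex n → Set
Connected P = ConnectedGraph (Flag P) (adj P)

Stab : ∀ {n} (P : Premaniplex n) → Flag P → Word n → Set
Stab P x w = act (adj P) w x ≡ x

-- An element P_ω(y) of the fundamental groupoid is
-- determined by its start y and ω ∈ C^m, so η is a function of (y, ω)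
-- respecting ≈.  Concatenation: P_{ω₁}(y) P_{ω₂}(ω₁ y) = P_{ω₂ω₁}(y), and
-- η(W₁W₂) = η(W₂)η(W₁).

record VoltageOperator (n m : ℕ) : Set₁ where
  field
    Y      : Premaniplex m
    η      : Flag Y → Word m → Word n
    η-resp : ∀ y {ω ω′} → ω ≈ ω′ → η y ω ≈ η y ω′
    η-comp : ∀ y ω₁ ω₂ →
             η y (ω₂ · ω₁) ≈ (η (act (adj Y) ω₁ y) ω₂ · η y ω₁)
open VoltageOperator public

-- flag graph of X ⋊_η Y :  (x,y)^i = (η(P_{r_i}(y)) x , y^i)
⋊adj : ∀ {n m} → (X : Premaniplex n) → (V : VoltageOperator n m) →
       Fin m → Flag X × Flag (Y V) → Flag X × Flag (Y V)
⋊adj X V i (x , y) = act (adj X) (η V y [ i ]) x , adj (Y V) i y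

PreservesConnectivity : ∀ {n m} → VoltageOperator n m → Set₁
PreservesConnectivity {n} V =
  (X′ : Premaniplex n) → Connected X′ →
  ConnectedGraph (Flag X′ × Flag (Y V)) (⋊adj X′ V)

-- Spanning trees.  A set of darts is a predicate T y i ("the i-dart at y");
-- walks are listed in traversal order.

TWalk : ∀ {m} (P : Premaniplex m) → (Flag P → Fin m → Set) → Flag P → Word m → Set
TWalk P T y [] = ⊤
TWalk P T y (i ∷ is) = T y i × TWalk P T (adj P i y) is

walkEnd : ∀ {m} (P : Premaniplex m) → Flag P → Word m → Flag P
walkEnd P y [] = y
walkEnd P y (i ∷ is) = walkEnd P (adj P i y) is

-- no backtracking: consecutive darts are never reverses of each other,
-- i.e. consecutive colours differ
NoBacktrack : ∀ {m} → Word m → Set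
NoBacktrack [] = ⊤
NoBacktrack (i ∷ []) = ⊤
NoBacktrack (i ∷ j ∷ is) = i ≢ j × NoBacktrack (j ∷ is)

record SpanningTree {m} (P : Premaniplex m) (T : Flag P → Fin m → Set) : Set where
  field
    closed   : ∀ y i → T y i → T (adj P i y) i     -- T is a set of edges
    spanning : ∀ y y′ → ∃ λ is → TWalk P T y is × walkEnd P y is ≡ y′
    acyclic  : ∀ y is → ¬ (is ≡ []) → TWalk P T y is → NoBacktrack is →
               ¬ (walkEnd P y is ≡ y)

HasTrivialSpanningTree : ∀ {n m} → VoltageOperator n m → Set₁
HasTrivialSpanningTree V =
  Σ (Flag (Y V) → Fin _ → Set) λ T →
    SpanningTree (Y V) T × (∀ y i → T y i → η V y [ i ] ≈ [])

ζ⁻¹N : ∀ {n m} (X : Premaniplex n) → Flag X → (V : VoltageOperator n m) →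
       Flag (Y V) → Word m → Set
ζ⁻¹N X x₀ V y₀ ω = Stab (Y V) y₀ ω × Stab X x₀ (η V y₀ ω)

InNorm : ∀ {m} → (Word m → Set) → Word m → Set
InNorm H υ = ∀ ω → (H ω → H (υ ⁻¹ · (ω · υ))) × (H (υ ⁻¹ · (ω · υ)) → H ω)

-- ζ(L ∩ L^υ) with L^υ = υ⁻¹ L υ
ζLL : ∀ {n m} (V : VoltageOperator n m) → Flag (Y V) → Word m → Word n → Set
ζLL V y₀ υ κ = ∃ λ ω → Stab (Y V) y₀ ω × Stab (Y V) y₀ (υ · (ω · υ ⁻¹)) × (η V y₀ ω ≈ κ)

-- The coset premaniplex C^n / K: flags are cosets ωK (represented by words,
-- ωK = ω′K iff ω⁻¹ω′ ∈ K), with i-adjacency ωK ↦ r_i ωK.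
-- X covers C^n/K iff there is a surjective homomorphism of flag graphs.

SameCoset : ∀ {n} → (Word n → Set) → Word n → Word n → Set
SameCoset K u v = K (u ⁻¹ · v)

CoversCoset : ∀ {n} → Premaniplex n → (Word n → Set) → Set
CoversCoset X K =
  Σ (Flag X → Word _) λ f →
    (∀ x i → SameCoset K (f (adj X i x)) (i ∷ f x)) ×
    (∀ ω → ∃ λ x → SameCoset K (f x) ω)

{-# OPTIONS --safe #-}
-- A connected premaniplex X is the coset premaniplex C^n/N, so it covers
-- C^n/K as soon as N ⊆ K.  For K = ζ(L ∩ L^υ) this inclusion holds because ζ
-- is onto C^n: the operator preserves the connectivity of U ⋊_η Y, where U is
-- a connected premaniplex on which C^n acts freely, and a path in U ⋊_η Y from
-- (u₀, y₀) to (κ u₀, y₀) is an ω ∈ L with ζ(ω) = κ.  If moreover κ ∈ N, then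
-- ω ∈ ζ⁻¹(N), hence υωυ⁻¹ ∈ ζ⁻¹(N) ⊆ L since υ normalises ζ⁻¹(N); that is,
-- ω ∈ L ∩ L^υ and κ ∈ ζ(L ∩ L^υ).
module Submission where

open import Defs
open import Relation.Nullary using (¬_; yes)
open import Data.Nat using (ℕ; s≤s; z≤n)
open import Data.Fin using (Fin; zero; suc)
open import Data.List using (List; []; _∷_; _++_; reverse; [_]; map)
open import Data.List.Properties using (++-assoc; unfold-reverse; ++-identityʳ)
import Data.List.Properties as List
import Data.Product.Properties as Product
open import Data.Bool using (Bool; true; false; not; if_then_else_)
import Data.Bool as Bool
open import Data.Product using (Σ; ∃; _×_; _,_; proj₁; proj₂)
open import Data.Sum using (_⊎_; inj₁; inj₂)
open import Data.Unit using (⊤; tt)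
open import Relation.Binary.PropositionalEquality hiding ([_])
open import Relation.Binary.Definitions using (DecidableEquality)
open import Axiom.UniquenessOfIdentityProofs using (module Decidable⇒UIP)

≡⇒≈ : ∀ {n} {u v : Word n} → u ≡ v → u ≈ v
≡⇒≈ refl = ≈-refl

≈-++ˡ : ∀ {n} {u v : Word n} a → u ≈ v → a ++ u ≈ a ++ v
≈-++ˡ a ≈-refl = ≈-refl
≈-++ˡ a (≈-sym e) = ≈-sym (≈-++ˡ a e)
≈-++ˡ a (≈-trans e e′) = ≈-trans (≈-++ˡ a e) (≈-++ˡ a e′)
≈-++ˡ a (≈-inv a′ b i) =
  subst₂ _≈_ (++-assoc a a′ _) (++-assoc a a′ b) (≈-inv (a ++ a′) b i)
≈-++ˡ a (≈-comm a′ b i j f) =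
  subst₂ _≈_ (++-assoc a a′ _) (++-assoc a a′ _) (≈-comm (a ++ a′) b i j f)

≈-++ʳ : ∀ {n} {u v : Word n} c → u ≈ v → u ++ c ≈ v ++ c
≈-++ʳ c ≈-refl = ≈-refl
≈-++ʳ c (≈-sym e) = ≈-sym (≈-++ʳ c e)
≈-++ʳ c (≈-trans e e′) = ≈-trans (≈-++ʳ c e) (≈-++ʳ c e′)
≈-++ʳ c (≈-inv a b i) =
  subst₂ _≈_ (sym (++-assoc a _ c)) (sym (++-assoc a b c)) (≈-inv a (b ++ c) i)
≈-++ʳ c (≈-comm a b i j f) =
  subst₂ _≈_ (sym (++-assoc a _ c)) (sym (++-assoc a _ c)) (≈-comm a (b ++ c) i j f)

⁻¹-inverseˡ : ∀ {n} (u : Word n) → u ⁻¹ · u ≈ []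
⁻¹-inverseˡ [] = ≈-refl
⁻¹-inverseˡ (i ∷ u) =
  ≈-trans (≡⇒≈ (trans (cong (_++ i ∷ u) (unfold-reverse i u)) (++-assoc (reverse u) [ i ] (i ∷ u))))
    (≈-trans (≈-inv (reverse u) u i) (⁻¹-inverseˡ u))

conjugate-undo : ∀ {n} (υ ω : Word n) → υ ⁻¹ · ((υ · (ω · υ ⁻¹)) · υ) ≈ ω
conjugate-undo υ ω = ≈-trans (≈-++ˡ (υ ⁻¹) υωυ⁻¹υ≈υω)
  (≈-trans (≡⇒≈ (sym (++-assoc (υ ⁻¹) υ ω))) (≈-++ʳ ω (⁻¹-inverseˡ υ)))
  where
  υωυ⁻¹υ≈υω : (υ · (ω · υ ⁻¹)) · υ ≈ υ · ω
  υωυ⁻¹υ≈υω =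
    ≈-trans (≡⇒≈ (trans (++-assoc υ (ω ++ υ ⁻¹) υ) (cong (υ ++_) (++-assoc ω (υ ⁻¹) υ))))
      (≈-trans (≈-++ˡ υ (≈-++ˡ ω (⁻¹-inverseˡ υ))) (≡⇒≈ (cong (υ ++_) (++-identityʳ ω))))

act-++ : ∀ {n} {F : Set} (f : Fin n → F → F) a b x →
         act f (a ++ b) x ≡ act f a (act f b x)
act-++ f [] b x = refl
act-++ f (i ∷ a) b x = cong (f i) (act-++ f a b x)

module Action {n} (P : Premaniplex n) where

  private
    A : Fin n → Flag P → Flag P
    A = adj P

  act-⁻¹-cancel : ∀ u x → act A (u ⁻¹) (act A u x) ≡ x
  act-⁻¹-cancel [] x = refl
  act-⁻¹-cancel (i ∷ u) x = begin
    act A (reverse (i ∷ u)) (A i (act A u x))     ≡⟨ cong (λ z → act A z (A i (act A u x))) (unfold-reverse i u) ⟩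
    act A (reverse u ++ [ i ]) (A i (act A u x))  ≡⟨ act-++ A (reverse u) [ i ] _ ⟩
    act A (reverse u) (A i (A i (act A u x)))     ≡⟨ cong (act A (reverse u)) (adj-inv P i _) ⟩
    act A (reverse u) (act A u x)                 ≡⟨ act-⁻¹-cancel u x ⟩
    x                                             ∎
    where open ≡-Reasoning

  adj-comm : ∀ i j y → Far i j → A i (A j y) ≡ A j (A i y)
  adj-comm i j y f = begin
    A i (A j y)                     ≡⟨ sym (adj-alt P i j (A i (A j y)) f) ⟩
    A j (A i (A j (A i (A i (A j y))))) ≡⟨ cong (λ z → A j (A i (A j z))) (adj-inv P i (A j y)) ⟩
    A j (A i (A j (A j y)))         ≡⟨ cong (λ z → A j (A i z)) (adj-inv P j y) ⟩
    A j (A i y)                     ∎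
    where open ≡-Reasoning

  act-resp-≈ : ∀ {u v} → u ≈ v → ∀ x → act A u x ≡ act A v x
  act-resp-≈ ≈-refl x = refl
  act-resp-≈ (≈-sym e) x = sym (act-resp-≈ e x)
  act-resp-≈ (≈-trans e e′) x = trans (act-resp-≈ e x) (act-resp-≈ e′ x)
  act-resp-≈ (≈-inv a b i) x =
    trans (act-++ A a _ x) (trans (cong (act A a) (adj-inv P i (act A b x))) (sym (act-++ A a b x)))
  act-resp-≈ (≈-comm a b i j f) x =
    trans (act-++ A a _ x) (trans (cong (act A a) (adj-comm i j (act A b x) f)) (sym (act-++ A a _ x)))

  Stab-⁻¹· : ∀ {x} u v → act A u x ≡ act A v x → Stab P x (u ⁻¹ · v)
  Stab-⁻¹· {x} u v e = begin
    act A (u ⁻¹ ++ v) x       ≡⟨ act-++ A (u ⁻¹) v x ⟩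
    act A (u ⁻¹) (act A v x)  ≡⟨ cong (act A (u ⁻¹)) (sym e) ⟩
    act A (u ⁻¹) (act A u x)  ≡⟨ act-⁻¹-cancel u x ⟩
    x                         ∎
    where open ≡-Reasoning

-- A connected premaniplex on which C^n acts freely

-- A code stores, for each k, the occurrences of r_k (false) and r_{k+1}
-- (true) in a word, most recent first.  A toggle pops when the leading run of
-- its letter has odd length: testing parity rather than the head keeps every
-- toggle an involution on all codes, reachable or not.

Code : ℕ → Set
Code ℕ.zero = ⊤
Code (ℕ.suc n) = List Bool × Code n

code₀ : ∀ n → Code n
code₀ ℕ.zero = tt
code₀ (ℕ.suc n) = [] , code₀ n

tail : List Bool → List Bool
tail [] = []
tail (_ ∷ L) = L

oddRun₀ : List Bool → Bool
oddRun₀ (false ∷ L) = not (oddRun₀ L)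
oddRun₀ _ = false

toggle₀ : List Bool → List Bool
toggle₀ L = if oddRun₀ L then tail L else false ∷ L

oddRun₁ : List Bool → List Bool → Bool
oddRun₁ (true ∷ L) (false ∷ M) = not (oddRun₁ L M)
oddRun₁ _ _ = false

toggle₁ : List Bool × List Bool → List Bool × List Bool
toggle₁ (L , M) = if oddRun₁ L M then (tail L , tail M) else (true ∷ L , false ∷ M)

_◂_ : ∀ {n} → List Bool × List Bool → Code n → Code (ℕ.suc (ℕ.suc n))
(L , M) ◂ t = L , (M , t)

toggle : ∀ {n} → Fin n → Code n → Code n
toggle zero (L , t) = toggle₀ L , t
toggle (suc zero) (L , (M , t)) = toggle₁ (L , M) ◂ t
toggle (suc (suc k)) (L , t) = L , toggle (suc k) t

push : ∀ {n} → Fin n → Code n → Code n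
push zero (L , t) = false ∷ L , t
push (suc zero) (L , (M , t)) = true ∷ L , (false ∷ M , t)
push (suc (suc k)) (L , t) = L , push (suc k) t

not≡true : ∀ {b} → not b ≡ true → b ≡ false
not≡true {false} _ = refl

toggle₀-involutive : ∀ L → toggle₀ (toggle₀ L) ≡ L
toggle₀-involutive L with oddRun₀ L in eq
... | false rewrite eq = refl
toggle₀-involutive (false ∷ L) | true rewrite not≡true eq = refl

toggle₁-involutive : ∀ p → toggle₁ (toggle₁ p) ≡ p
toggle₁-involutive (L , M) with oddRun₁ L M in eq
... | false rewrite eq = refl
toggle₁-involutive (true ∷ L , false ∷ M) | true rewrite not≡true eq = refl

toggle-involutive : ∀ {n} (i : Fin n) s → toggle i (toggle i s) ≡ s
toggle-involutive zero (L , t) = cong (_, t) (toggle₀-involutive L)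
toggle-involutive (suc zero) (L , (M , t)) = cong (_◂ t) (toggle₁-involutive (L , M))
toggle-involutive (suc (suc k)) (L , t) = cong (L ,_) (toggle-involutive (suc k) t)

toggle-alt : ∀ {n} (i j : Fin n) s → Far i j →
             toggle j (toggle i (toggle j (toggle i s))) ≡ s
toggle-alt zero zero s ()
toggle-alt zero (suc zero) s (s≤s ())
toggle-alt zero (suc (suc k)) (L , t) f =
  cong₂ _,_ (toggle₀-involutive L) (toggle-involutive (suc k) t)
toggle-alt (suc zero) zero s (s≤s ())
toggle-alt (suc zero) (suc zero) s ()
toggle-alt (suc zero) (suc (suc zero)) s (s≤s ())
toggle-alt (suc zero) (suc (suc (suc k))) (L , (M , t)) f =
  cong₂ _◂_ (toggle₁-involutive (L , M)) (toggle-involutive (suc k) t)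
toggle-alt (suc (suc k)) zero (L , t) f =
  cong₂ _,_ (toggle₀-involutive L) (toggle-involutive (suc k) t)
toggle-alt (suc (suc zero)) (suc zero) s (s≤s ())
toggle-alt (suc (suc (suc k))) (suc zero) (L , (M , t)) f =
  cong₂ _◂_ (toggle₁-involutive (L , M)) (toggle-involutive (suc k) t)
toggle-alt (suc (suc k)) (suc (suc l)) (L , t) f =
  cong (L ,_) (toggle-alt (suc k) (suc l) t f)

toggle₀-pushes-or-pops : ∀ L → toggle₀ L ≡ false ∷ L ⊎ L ≡ false ∷ toggle₀ L
toggle₀-pushes-or-pops L with oddRun₀ L in eq
... | false = inj₁ refl
toggle₀-pushes-or-pops (false ∷ L) | true = inj₂ refl

toggle₁-pushes-or-pops : ∀ L M →
  toggle₁ (L , M) ≡ (true ∷ L , false ∷ M) ⊎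
  (L , M) ≡ (true ∷ proj₁ (toggle₁ (L , M)) , false ∷ proj₂ (toggle₁ (L , M)))
toggle₁-pushes-or-pops L M with oddRun₁ L M in eq
... | false = inj₁ refl
toggle₁-pushes-or-pops (true ∷ L) (false ∷ M) | true = inj₂ refl

toggle-pushes-or-pops : ∀ {n} (i : Fin n) s →
                        toggle i s ≡ push i s ⊎ s ≡ push i (toggle i s)
toggle-pushes-or-pops zero (L , t) with toggle₀-pushes-or-pops L
... | inj₁ e = inj₁ (cong (_, t) e)
... | inj₂ e = inj₂ (cong (_, t) e)
toggle-pushes-or-pops (suc zero) (L , (M , t)) with toggle₁-pushes-or-pops L M
... | inj₁ e = inj₁ (cong (_◂ t) e)
... | inj₂ e = inj₂ (cong (_◂ t) e)
toggle-pushes-or-pops (suc (suc k)) (L , t) with toggle-pushes-or-pops (suc k) t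
... | inj₁ e = inj₁ (cong (L ,_) e)
... | inj₂ e = inj₂ (cong (L ,_) e)

-- weave L w inserts the r_0 recorded by L into a word w in the remaining
-- generators; weaveAfter₁ L w first skips past the next r_1 of w.
weave : ∀ {n} → List Bool → Word (ℕ.suc n) → Word (ℕ.suc n)
weaveAfter₁ : ∀ {n} → List Bool → Word (ℕ.suc n) → Word (ℕ.suc n)
weave [] w = w
weave (false ∷ L) w = zero ∷ weave L w
weave (true ∷ L) w = weaveAfter₁ L w
weaveAfter₁ L [] = weave L []
weaveAfter₁ L (zero ∷ w) = zero ∷ weaveAfter₁ L w
weaveAfter₁ L (suc zero ∷ w) = suc zero ∷ weave L w
weaveAfter₁ L (suc (suc k) ∷ w) = suc (suc k) ∷ weaveAfter₁ L w

decode : ∀ {n} → Code n → Word n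
decode {ℕ.zero} tt = []
decode {ℕ.suc n} (L , t) = weave L (map suc (decode t))

decode-code₀ : ∀ n → decode (code₀ n) ≡ []
decode-code₀ ℕ.zero = refl
decode-code₀ (ℕ.suc n) = cong (map suc) (decode-code₀ n)

-- Equality up to commuting far generators, generated by moves at the head so
-- that weave can be pushed through it by induction on derivations.
infix 4 _~_
data _~_ {n : ℕ} : Word n → Word n → Set where
  ~-refl  : ∀ {u} → u ~ u
  ~-sym   : ∀ {u v} → u ~ v → v ~ u
  ~-trans : ∀ {u v w} → u ~ v → v ~ w → u ~ w
  ~-swap  : ∀ {i j w} → Far i j → i ∷ j ∷ w ~ j ∷ i ∷ w
  ~-cons  : ∀ {i u v} → u ~ v → i ∷ u ~ i ∷ v

~⇒≈ : ∀ {n} {u v : Word n} → u ~ v → u ≈ v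
~⇒≈ ~-refl = ≈-refl
~⇒≈ (~-sym e) = ≈-sym (~⇒≈ e)
~⇒≈ (~-trans e e′) = ≈-trans (~⇒≈ e) (~⇒≈ e′)
~⇒≈ (~-swap {i} {j} {w} f) = ≈-comm [] w i j f
~⇒≈ (~-cons {i} e) = ≈-++ˡ [ i ] (~⇒≈ e)

~-map-suc : ∀ {n} {u v : Word n} → u ~ v → map suc u ~ map suc v
~-map-suc ~-refl = ~-refl
~-map-suc (~-sym e) = ~-sym (~-map-suc e)
~-map-suc (~-trans e e′) = ~-trans (~-map-suc e) (~-map-suc e′)
~-map-suc (~-swap f) = ~-swap f
~-map-suc (~-cons e) = ~-cons (~-map-suc e)

weave-far : ∀ {m} L (k : Fin m) (w : Word (ℕ.suc (ℕ.suc m))) →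
            weave L (suc (suc k) ∷ w) ~ suc (suc k) ∷ weave L w
weave-far [] k w = ~-refl
weave-far (false ∷ L) k w = ~-trans (~-cons (weave-far L k w)) (~-swap (s≤s (s≤s z≤n)))
weave-far (true ∷ L) k w = ~-refl

weave-resp-~ : ∀ {n} {u v : Word (ℕ.suc n)} → u ~ v → ∀ L → weave L u ~ weave L v
weaveAfter₁-resp-~ : ∀ {n} {u v : Word (ℕ.suc n)} → u ~ v → ∀ L →
                     weaveAfter₁ L u ~ weaveAfter₁ L v
weave-resp-~ ~-refl L = ~-refl
weave-resp-~ (~-sym e) L = ~-sym (weave-resp-~ e L)
weave-resp-~ (~-trans e e′) L = ~-trans (weave-resp-~ e L) (weave-resp-~ e′ L)
weave-resp-~ (~-swap f) [] = ~-swap f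
weave-resp-~ (~-swap {i} {j} {w} f) (false ∷ L) = ~-cons (weave-resp-~ (~-swap {i = i} {j} {w} f) L)
weave-resp-~ (~-swap {i} {j} {w} f) (true ∷ L) = weaveAfter₁-resp-~ (~-swap {i = i} {j} {w} f) L
weave-resp-~ (~-cons e) [] = ~-cons e
weave-resp-~ (~-cons {i} e) (false ∷ L) = ~-cons (weave-resp-~ (~-cons {i = i} e) L)
weave-resp-~ (~-cons {i} e) (true ∷ L) = weaveAfter₁-resp-~ (~-cons {i = i} e) L
weaveAfter₁-resp-~ ~-refl L = ~-refl
weaveAfter₁-resp-~ (~-sym e) L = ~-sym (weaveAfter₁-resp-~ e L)
weaveAfter₁-resp-~ (~-trans e e′) L = ~-trans (weaveAfter₁-resp-~ e L) (weaveAfter₁-resp-~ e′ L)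
weaveAfter₁-resp-~ (~-cons {zero} e) L = ~-cons (weaveAfter₁-resp-~ e L)
weaveAfter₁-resp-~ (~-cons {suc zero} e) L = ~-cons (weave-resp-~ e L)
weaveAfter₁-resp-~ (~-cons {suc (suc k)} e) L = ~-cons (weaveAfter₁-resp-~ e L)
weaveAfter₁-resp-~ (~-swap {zero} {zero} ()) L
weaveAfter₁-resp-~ (~-swap {zero} {suc zero} (s≤s ())) L
weaveAfter₁-resp-~ (~-swap {zero} {suc (suc k)} f) L = ~-swap f
weaveAfter₁-resp-~ (~-swap {suc zero} {zero} (s≤s ())) L
weaveAfter₁-resp-~ (~-swap {suc zero} {suc zero} ()) L
weaveAfter₁-resp-~ (~-swap {suc zero} {suc (suc zero)} (s≤s ())) L
weaveAfter₁-resp-~ (~-swap {suc zero} {suc (suc (suc k))} {w} f) L =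
  ~-trans (~-cons (weave-far L (suc k) w)) (~-swap f)
weaveAfter₁-resp-~ (~-swap {suc (suc k)} {zero} f) L = ~-swap f
weaveAfter₁-resp-~ (~-swap {suc (suc zero)} {suc zero} (s≤s ())) L
weaveAfter₁-resp-~ (~-swap {suc (suc (suc k))} {suc zero} {w} f) L =
  ~-trans (~-swap f) (~-cons (~-sym (weave-far L (suc k) w)))
weaveAfter₁-resp-~ (~-swap {suc (suc k)} {suc (suc l)} f) L = ~-swap f

decode-push : ∀ {n} (i : Fin n) s → decode (push i s) ~ i ∷ decode s
decode-push zero (L , t) = ~-refl
decode-push (suc zero) (L , (M , t)) = ~-refl
decode-push (suc (suc k)) (L , t) =
  ~-trans (weave-resp-~ (~-map-suc (decode-push (suc k) t)) L) (weave-far L k _)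

decode-toggle : ∀ {n} (i : Fin n) s → decode (toggle i s) ≈ i ∷ decode s
decode-toggle i s with toggle-pushes-or-pops i s
... | inj₁ e = subst (λ z → decode z ≈ i ∷ decode s) (sym e) (~⇒≈ (decode-push i s))
... | inj₂ e = ≈-sym (≈-trans (≈-++ˡ [ i ] (≡⇒≈ (cong decode e)))
                 (≈-trans (≈-++ˡ [ i ] (~⇒≈ (decode-push i (toggle i s))))
                   (≈-inv [] (decode (toggle i s)) i)))

decode-act : ∀ {n} (u : Word n) → decode (act toggle u (code₀ n)) ≈ u
decode-act {n} [] = ≡⇒≈ (decode-code₀ n)
decode-act (i ∷ u) = ≈-trans (decode-toggle i _) (≈-++ˡ [ i ] (decode-act u))

Code-≟ : ∀ n → DecidableEquality (Code n)
Code-≟ ℕ.zero tt tt = yes refl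
Code-≟ (ℕ.suc n) = Product.≡-dec (List.≡-dec Bool._≟_) (Code-≟ n)

CodePremaniplex : ∀ n → Premaniplex n
CodePremaniplex n = record
  { Flag = Code n ; adj = toggle ; adj-inv = toggle-involutive ; adj-alt = toggle-alt }

module Universal (n : ℕ) where

  private
    module C = Action (CodePremaniplex n)

  Reachable : Code n → Set
  Reachable s = act toggle (decode s) (code₀ n) ≡ s

  ≡-Reachable : ∀ {s : Code n} (p q : Reachable s) → p ≡ q
  ≡-Reachable = Decidable⇒UIP.≡-irrelevant (Code-≟ n)

  Flag′ : Set
  Flag′ = Σ (Code n) Reachable

  flag-≡ : ∀ {a b : Flag′} → proj₁ a ≡ proj₁ b → a ≡ b
  flag-≡ {s , p} {.s , q} refl = cong (s ,_) (≡-Reachable p q)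

  toggle-Reachable : ∀ i s → Reachable s → Reachable (toggle i s)
  toggle-Reachable i s p = trans (C.act-resp-≈ (decode-toggle i s) (code₀ n)) (cong (toggle i) p)

  U : Premaniplex n
  U = record
    { Flag = Flag′
    ; adj = λ i (s , p) → toggle i s , toggle-Reachable i s p
    ; adj-inv = λ i x → flag-≡ (toggle-involutive i (proj₁ x))
    ; adj-alt = λ i j x f → flag-≡ (toggle-alt i j (proj₁ x) f)
    }

  u₀ : Flag U
  u₀ = code₀ n , cong (λ w → act toggle w (code₀ n)) (decode-code₀ n)

  proj₁-act : ∀ w (x : Flag U) → proj₁ (act (adj U) w x) ≡ act toggle w (proj₁ x)
  proj₁-act [] x = refl
  proj₁-act (i ∷ w) x = cong (toggle i) (proj₁-act w x)

  U-connected : Connected U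
  U-connected (s , p) (s′ , p′) = w , flag-≡ (begin
    proj₁ (act (adj U) w (s , p))                        ≡⟨ proj₁-act w (s , p) ⟩
    act toggle w s                                       ≡⟨ act-++ toggle (decode s′) (decode s ⁻¹) s ⟩
    act toggle (decode s′) (act toggle (decode s ⁻¹) s)  ≡⟨ cong (λ z → act toggle (decode s′) (act toggle (decode s ⁻¹) z)) (sym p) ⟩
    act toggle (decode s′) (act toggle (decode s ⁻¹) (act toggle (decode s) (code₀ n)))
      ≡⟨ cong (act toggle (decode s′)) (C.act-⁻¹-cancel (decode s) (code₀ n)) ⟩
    act toggle (decode s′) (code₀ n)                     ≡⟨ p′ ⟩
    s′                                                   ∎)
    where
    open ≡-Reasoning
    w : Word n
    w = decode s′ · decode s ⁻¹

  U-free : ∀ u v → act (adj U) u u₀ ≡ act (adj U) v u₀ → u ≈ v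
  U-free u v e = ≈-trans (≈-sym (decode-act u)) (≈-trans (≡⇒≈ (cong decode same-code)) (decode-act v))
    where
    same-code : act toggle u (code₀ n) ≡ act toggle v (code₀ n)
    same-code = trans (sym (proj₁-act u u₀)) (trans (cong proj₁ e) (proj₁-act v u₀))

module _ {n m} (X : Premaniplex n) (V : VoltageOperator n m) where

  private
    module X = Action X

  η-[]-acts-trivially : ∀ y x → act (adj X) (η V y []) x ≡ x
  η-[]-acts-trivially y x = begin
    e x              ≡⟨ sym (X.act-⁻¹-cancel (η V y []) (e x)) ⟩
    e⁻¹ (e (e x))    ≡⟨ cong e⁻¹ (sym e·e≡e) ⟩
    e⁻¹ (e x)        ≡⟨ X.act-⁻¹-cancel (η V y []) x ⟩
    x                ∎
    where
    open ≡-Reasoning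
    e e⁻¹ : Flag X → Flag X
    e = act (adj X) (η V y [])
    e⁻¹ = act (adj X) (η V y [] ⁻¹)
    e·e≡e : e x ≡ e (e x)
    e·e≡e = trans (X.act-resp-≈ (η-comp V y [] []) x) (act-++ (adj X) (η V y []) (η V y []) x)

  proj₂-act-⋊ : ∀ w x y → proj₂ (act (⋊adj X V) w (x , y)) ≡ act (adj (Y V)) w y
  proj₂-act-⋊ [] x y = refl
  proj₂-act-⋊ (i ∷ w) x y = cong (adj (Y V) i) (proj₂-act-⋊ w x y)

  proj₁-act-⋊ : ∀ w x y → proj₁ (act (⋊adj X V) w (x , y)) ≡ act (adj X) (η V y w) x
  proj₁-act-⋊ [] x y = sym (η-[]-acts-trivially y x)
  proj₁-act-⋊ (i ∷ w) x y = begin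
    act (adj X) (η V (proj₂ (act (⋊adj X V) w (x , y))) [ i ]) (proj₁ (act (⋊adj X V) w (x , y)))
      ≡⟨ cong₂ (λ a b → act (adj X) (η V b [ i ]) a) (proj₁-act-⋊ w x y) (proj₂-act-⋊ w x y) ⟩
    act (adj X) (η V (act (adj (Y V)) w y) [ i ]) (act (adj X) (η V y w) x)
      ≡⟨ sym (act-++ (adj X) (η V (act (adj (Y V)) w y) [ i ]) (η V y w) x) ⟩
    act (adj X) (η V (act (adj (Y V)) w y) [ i ] · η V y w) x
      ≡⟨ X.act-resp-≈ (≈-sym (η-comp V y w [ i ])) x ⟩
    act (adj X) (η V y (i ∷ w)) x
      ∎
    where open ≡-Reasoning

ζ-surjective : ∀ {n m} (V : VoltageOperator n m) → PreservesConnectivity V →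
               ∀ y₀ κ → ∃ λ ω → Stab (Y V) y₀ ω × η V y₀ ω ≈ κ
ζ-surjective {n} V preserves y₀ κ = ω , ω∈L , U-free (η V y₀ ω) κ ζω·u₀≡κ·u₀
  where
  open Universal n using (U; u₀; U-connected; U-free)
  walk : ∃ λ ω → act (⋊adj U V) ω (u₀ , y₀) ≡ (act (adj U) κ u₀ , y₀)
  walk = preserves U U-connected (u₀ , y₀) (act (adj U) κ u₀ , y₀)
  ω : Word _
  ω = proj₁ walk
  ω∈L : Stab (Y V) y₀ ω
  ω∈L = trans (sym (proj₂-act-⋊ U V ω u₀ y₀)) (cong proj₂ (proj₂ walk))
  ζω·u₀≡κ·u₀ : act (adj U) (η V y₀ ω) u₀ ≡ act (adj U) κ u₀
  ζω·u₀≡κ·u₀ = trans (sym (proj₁-act-⋊ U V ω u₀ y₀)) (cong proj₁ (proj₂ walk))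

ζ⁻¹N-resp-≈ : ∀ {n m} (X : Premaniplex n) x₀ (V : VoltageOperator n m) y₀ {ω ω′} →
              ω ≈ ω′ → ζ⁻¹N X x₀ V y₀ ω → ζ⁻¹N X x₀ V y₀ ω′
ζ⁻¹N-resp-≈ X x₀ V y₀ e (ω∈L , ζω∈N) =
  trans (sym (Action.act-resp-≈ (Y V) e y₀)) ω∈L ,
  trans (sym (Action.act-resp-≈ X (η-resp V y₀ e) x₀)) ζω∈N

Stab⊆ζLL : ∀ {n m} (X : Premaniplex n) x₀ (V : VoltageOperator n m) →
           PreservesConnectivity V → ∀ y₀ υ → InNorm (ζ⁻¹N X x₀ V y₀) υ →
           ∀ κ → Stab X x₀ κ → ζLL V y₀ υ κ
Stab⊆ζLL X x₀ V preserves y₀ υ normalises κ κ∈N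
  with ζ-surjective V preserves y₀ κ
... | ω , ω∈L , ζω≈κ = ω , ω∈L , proj₁ υωυ⁻¹∈ζ⁻¹N , ζω≈κ
  where
  ω∈ζ⁻¹N : ζ⁻¹N X x₀ V y₀ ω
  ω∈ζ⁻¹N = ω∈L , trans (Action.act-resp-≈ X ζω≈κ x₀) κ∈N
  υωυ⁻¹∈ζ⁻¹N : ζ⁻¹N X x₀ V y₀ (υ · (ω · υ ⁻¹))
  υωυ⁻¹∈ζ⁻¹N = proj₂ (normalises (υ · (ω · υ ⁻¹)))
                 (ζ⁻¹N-resp-≈ X x₀ V y₀ (≈-sym (conjugate-undo υ ω)) ω∈ζ⁻¹N)

covers-coset-⊇Stab : ∀ {n} (X : Premaniplex n) x₀ → Connected X →
                     (K : Word n → Set) → (∀ κ → Stab X x₀ κ → K κ) →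
                     CoversCoset X K
covers-coset-⊇Stab X x₀ connected K Stab⊆K = word , homomorphic , surjective
  where
  word : Flag X → Word _
  word x = proj₁ (connected x₀ x)
  word-reaches : ∀ x → act (adj X) (word x) x₀ ≡ x
  word-reaches x = proj₂ (connected x₀ x)
  homomorphic : ∀ x i → SameCoset K (word (adj X i x)) (i ∷ word x)
  homomorphic x i = Stab⊆K _ (Action.Stab-⁻¹· X (word (adj X i x)) (i ∷ word x)
    (trans (word-reaches (adj X i x)) (cong (adj X i) (sym (word-reaches x)))))
  surjective : ∀ ω → ∃ λ x → SameCoset K (word x) ω
  surjective ω = act (adj X) ω x₀ ,
    Stab⊆K _ (Action.Stab-⁻¹· X (word (act (adj X) ω x₀)) ω (word-reaches (act (adj X) ω x₀)))

lemma5p6 : ∀ {n m} (X : Premaniplex n) (x₀ : Flag X) → Connected X →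
    (V : VoltageOperator n m) → HasTrivialSpanningTree V →
    PreservesConnectivity V →
    (y₀ : Flag (Y V)) (υ : Word m) →
    InNorm (ζ⁻¹N X x₀ V y₀) υ → ¬ Stab (Y V) y₀ υ →
    CoversCoset X (ζLL V y₀ υ)
lemma5p6 X x₀ connected V _ preserves y₀ υ normalises _ =
  covers-coset-⊇Stab X x₀ connected (ζLL V y₀ υ)
    (Stab⊆ζLL X x₀ V preserves y₀ υ normalises)
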